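{- For every positive integer $n$, $T(n)=\sum_{r\geq1,\ r\mid n} T(r-1)$, where $T(0)=1$ by convention.
   Context: For a vector $A=(a_1,\ldots,a_k)$, $k\geq 1$, of positive integers define $f(A)$ recursively by $f(a_1)=a_1$ and $f(a_1,\ldots,a_{i+1})=(f(a_1,\ldots,a_i)+1)\,a_{i+1}$. For a positive integer $n$, $T(n)$ is the number of vectors $A$ (of any length $k\geq1$, with positive integer entries) such that $f(A)=n$; also $T(0):=1$. -}

module Defs where

open import Data.Nat using (ℕ; zero; suc; _+_; _*_; _∸_; _≤_)
open import Data.Nat.Divisibility using (_∣?_)
open import Data.List using (List; []; _∷_; length; foldl; map; filter; upTo)
open import Data.Nat.ListAction using (sum)
open import Data.List.NonEmpty using (List⁺; _∷_; toList)
open import Data.List.Relation.Unary.All using (All)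
open import Data.List.Relation.Unary.Unique.Propositional using (Unique)
open import Data.List.Membership.Propositional using (_∈_)
open import Data.Product using (Σ; _×_)
open import Relation.Binary.PropositionalEquality using (_≡_)
open import Function.Bundles using (_⇔_)

f : List⁺ ℕ → ℕ
f (a ∷ as) = foldl (λ acc x → (acc + 1) * x) a as

Valid : ℕ → List⁺ ℕ → Set
Valid n A = All (1 ≤_) (toList A) × f A ≡ n

HasCount : {A : Set} → (A → Set) → ℕ → Set
HasCount {A} P t =
  Σ (List A) λ L → Unique L × ((x : A) → (x ∈ L) ⇔ P x) × length L ≡ t

IsT : (ℕ → ℕ) → Set
IsT T = T 0 ≡ 1 × ((n : ℕ) → 1 ≤ n → HasCount (Valid n) (T n))

-- Σ_{1 ≤ r, r ∣ n} g(r)   (for n ≥ 1 the divisors lie in 1..n)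
divisorSum : ℕ → (ℕ → ℕ) → ℕ
divisorSum n g = sum (map g (filter (λ r → r ∣? n) (map suc (upTo n))))

module Submission where

-- Split a vector A with f(A) = n ≥ 1 according to its last entry.
-- Either A = (n) has one entry, or A = (B, z) and then n = (f(B) + 1)·z, so
-- r := f(B) + 1 ≥ 2 is a divisor of n and B is a vector with f(B) = r - 1
-- < n, while z = n / r is determined by r.  Conversely every divisor
-- r ≥ 2 of n and every B with f(B) = r - 1 give the vector (B, n/r).
-- Hence the vectors with f(A) = n are the disjoint union over the divisors
-- r of n of "pieces" of size T(r - 1) (with T(0) = 1 for the piece (n)).

open import Defs
open import Data.Nat using (ℕ; zero; suc; _+_; _*_; _∸_; _≤_; _<_; z≤n; s≤s; >-nonZero)
open import Data.Nat.Properties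
  using (+-comm; *-comm; *-zeroʳ; *-mono-≤; *-cancelˡ-≡; m≤n+m; suc-injective; ≤-trans; ≤-pred; ≤-refl)
open import Data.Nat.Divisibility using (_∣_; _∣?_; divides; 1∣_; ∣⇒≤)
open import Data.List using (List; []; _∷_; _++_; map; filter; foldl; upTo)
open import Data.List.Properties using (length-++; length-map; foldl-∷ʳ; ∷ʳ-injectiveˡ; ∷-injective)
open import Data.Nat.ListAction using (sum)
open import Data.List.NonEmpty using (List⁺; _∷_; toList; _⁺∷ʳ_; snocView; _∷ʳ′_)
open import Data.List.Membership.Propositional using (_∈_)
open import Data.List.Membership.Propositional.Properties
  using (++-∈⇔; ∈-map⁺; ∈-map⁻; ∈-filter⁺; ∈-filter⁻; ∈-upTo⁺)
open import Data.List.Membership.Propositional.Properties.WithK using (unique∧set⇒bag)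
open import Data.List.Relation.Binary.BagAndSetEquality using (∼bag⇒↭)
open import Data.List.Relation.Binary.Permutation.Propositional.Properties using (↭-length)
open import Data.List.Relation.Unary.All using (All; []; _∷_; lookup)
import Data.List.Relation.Unary.All.Properties as AllProperties
open import Data.List.Relation.Unary.AllPairs using ([]; _∷_)
open import Data.List.Relation.Unary.Any using (here; there)
open import Data.List.Relation.Unary.Unique.Propositional using (Unique)
import Data.List.Relation.Unary.Unique.Propositional.Properties as Unique
open import Data.Empty using (⊥)
open import Data.Product using (Σ; ∃; _×_; _,_; proj₁; proj₂)
open import Data.Sum using (_⊎_; inj₁; inj₂)
open import Data.Sum.Function.Propositional using (_⊎-⇔_)
open import Function.Bundles using (_⇔_; mk⇔; Equivalence)
import Function.Properties.Equivalence as ⇔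
open import Relation.Binary.PropositionalEquality using (_≡_; _≢_; refl; sym; trans; cong; subst)
open import Relation.Nullary using (contradiction)

open Equivalence using (to; from)

module Counting {X : Set} where

  -- Counts are unique: two duplicate-free enumerations of the same
  -- predicate are permutations of each other, hence of equal length.
  HasCount-unique : ∀ {P : X → Set} {a b} → HasCount P a → HasCount P b → a ≡ b
  HasCount-unique (L , uL , mL , refl) (M , uM , mM , refl) =
    ↭-length (∼bag⇒↭ (unique∧set⇒bag uL uM λ {x} → ⇔.trans (mL x) (⇔.sym (mM x))))

  HasCount-cong : ∀ {P Q : X → Set} {c} → (∀ x → P x ⇔ Q x) → HasCount P c → HasCount Q c
  HasCount-cong P⇔Q (L , uL , mL , lenL) = L , uL , (λ x → ⇔.trans (mL x) (P⇔Q x)) , lenL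

  HasCount-singleton : (a : X) → HasCount (_≡ a) 1
  HasCount-singleton a = a ∷ [] , [] ∷ [] , (λ x → mk⇔ (λ { (here eq) → eq ; (there ()) }) here) , refl

  HasCount-image : ∀ {Y : Set} {P : X → Set} {c} (h : X → Y) → (∀ {x x'} → h x ≡ h x' → x ≡ x') →
                   HasCount P c → HasCount (λ y → ∃ λ x → P x × y ≡ h x) c
  HasCount-image h h-injective (L , uL , mL , lenL) =
    map h L , Unique.map⁺ h-injective uL ,
    (λ y → mk⇔ (λ y∈ → let (x , x∈ , eq) = ∈-map⁻ h y∈ in x , to (mL x) x∈ , eq)
               (λ { (x , px , refl) → ∈-map⁺ h (from (mL x) px) })) ,
    trans (length-map h L) lenL

  HasCount-⊎ : ∀ {P Q : X → Set} {a b} → (∀ {x} → P x → Q x → ⊥) →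
               HasCount P a → HasCount Q b → HasCount (λ x → P x ⊎ Q x) (a + b)
  HasCount-⊎ disjoint (L , uL , mL , refl) (M , uM , mM , refl) =
    L ++ M ,
    Unique.++⁺ uL uM (λ { (x∈L , x∈M) → disjoint (to (mL _) x∈L) (to (mM _) x∈M) }) ,
    (λ x → ⇔.trans ++-∈⇔ (mL x ⊎-⇔ mM x)) ,
    length-++ L

  HasCount-Σ : ∀ {I : Set} {P : I → X → Set} (c : I → ℕ) (is : List I) → Unique is →
               (∀ {i j x} → P i x → P j x → i ≡ j) →
               (∀ i → i ∈ is → HasCount (P i) (c i)) →
               HasCount (λ x → ∃ λ i → i ∈ is × P i x) (sum (map c is))
  HasCount-Σ c [] _ _ _ = [] , [] , (λ x → mk⇔ (λ ()) (λ { (_ , () , _) })) , refl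
  HasCount-Σ {P = P} c (i ∷ is) (i∉is ∷ uis) index-unique count =
    HasCount-cong split
      (HasCount-⊎ (λ { pix (j , j∈is , pjx) → i∉is-at (index-unique pix pjx) j∈is })
                  (count i (here refl))
                  (HasCount-Σ c is uis index-unique (λ j j∈is → count j (there j∈is))))
    where
    i∉is-at : ∀ {j} → i ≡ j → j ∈ is → ⊥
    i∉is-at refl j∈is = lookup i∉is j∈is refl
    split : ∀ x → (P i x ⊎ ∃ λ j → j ∈ is × P j x) ⇔ (∃ λ j → j ∈ i ∷ is × P j x)
    split x = mk⇔ (λ { (inj₁ pix) → i , here refl , pix
                     ; (inj₂ (j , j∈is , pjx)) → j , there j∈is , pjx })
                  (λ { (j , here refl , pjx) → inj₁ pjx
                     ; (j , there j∈is , pjx) → inj₂ (j , j∈is , pjx) })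

open Counting

f-⁺∷ʳ : ∀ B z → f (B ⁺∷ʳ z) ≡ (f B + 1) * z
f-⁺∷ʳ (b ∷ bs) z = foldl-∷ʳ (λ acc x → (acc + 1) * x) b z bs

⁺∷ʳ-injectiveˡ : ∀ {A : Set} {B B' : List⁺ A} {z z' : A} → B ⁺∷ʳ z ≡ B' ⁺∷ʳ z' → B ≡ B'
⁺∷ʳ-injectiveˡ {B = b ∷ bs} {b' ∷ bs'} eq
  with ∷-injective (∷ʳ-injectiveˡ (b ∷ bs) (b' ∷ bs') (cong toList eq))
... | refl , refl = refl

⁺∷ʳ≢[_] : ∀ {A : Set} {B : List⁺ A} {z : A} x → B ⁺∷ʳ z ≢ x ∷ []
⁺∷ʳ≢[_] {B = _ ∷ []} x ()
⁺∷ʳ≢[_] {B = _ ∷ _ ∷ _} x ()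

f-positive : ∀ A → All (1 ≤_) (toList A) → 1 ≤ f A
f-positive (a ∷ as) (1≤a ∷ 1≤as) = fold-positive a as 1≤a 1≤as
  where
  fold-positive : ∀ acc xs → 1 ≤ acc → All (1 ≤_) xs → 1 ≤ foldl (λ acc x → (acc + 1) * x) acc xs
  fold-positive acc []       1≤acc []           = 1≤acc
  fold-positive acc (x ∷ xs) 1≤acc (1≤x ∷ 1≤xs) =
    fold-positive ((acc + 1) * x) xs (*-mono-≤ (m≤n+m 1 acc) 1≤x) 1≤xs

Valid-⁺∷ʳ : ∀ n B z → Valid n (B ⁺∷ʳ z) ⇔ (All (1 ≤_) (toList B) × 1 ≤ z × (f B + 1) * z ≡ n)
Valid-⁺∷ʳ n B@(_ ∷ _) z = mk⇔
  (λ { (positive , refl) → let (1≤B , 1≤z) = AllProperties.∷ʳ⁻ positive in 1≤B , 1≤z , sym (f-⁺∷ʳ B z) })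
  (λ { (1≤B , 1≤z , refl) → AllProperties.∷ʳ⁺ 1≤B 1≤z , f-⁺∷ʳ B z })

factor-positive : ∀ r z → 1 ≤ r * z → 1 ≤ z
factor-positive r zero    1≤r*0 = contradiction (subst (1 ≤_) (*-zeroʳ r) 1≤r*0) λ ()
factor-positive r (suc z) _     = s≤s z≤n

divisors : ℕ → List ℕ
divisors n = filter (_∣? n) (map suc (upTo n))

divisors-unique : ∀ n → Unique (divisors n)
divisors-unique n = Unique.filter⁺ (_∣? n) (Unique.map⁺ suc-injective (Unique.upTo⁺ n))

∈-divisors : ∀ {n r} → 1 ≤ n → r ∈ divisors n ⇔ (1 ≤ r × r ∣ n)
∈-divisors {n} 1≤n = mk⇔ to′ from′
  where
  to′ : ∀ {r} → r ∈ divisors n → 1 ≤ r × r ∣ n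
  to′ r∈ with ∈-filter⁻ (_∣? n) {xs = map suc (upTo n)} r∈
  ... | r∈range , r∣n with ∈-map⁻ suc r∈range
  ... | _ , _ , refl = s≤s z≤n , r∣n
  from′ : ∀ {r} → 1 ≤ r × r ∣ n → r ∈ divisors n
  from′ (s≤s _ , r∣n) =
    ∈-filter⁺ (_∣? n) (∈-map⁺ suc (∈-upTo⁺ (∣⇒≤ {{>-nonZero 1≤n}} r∣n))) r∣n

-- Piece n r A: the vector A satisfies f(A) = n and r = f(prefix) + 1, where
-- the prefix is A without its last entry (with f of the empty prefix read
-- as 0).
Piece : ℕ → ℕ → List⁺ ℕ → Set
Piece n zero            A = ⊥
Piece n (suc zero)      A = A ≡ n ∷ []
Piece n (suc m@(suc _)) A = ∃ λ B → ∃ λ z → Valid m B × A ≡ B ⁺∷ʳ z × suc m * z ≡ n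

-- A vector lies in at most one piece: r is determined by the prefix.
Piece-index-unique : ∀ {n r r' A} → Piece n r A → Piece n r' A → r ≡ r'
Piece-index-unique {r = suc zero} {suc zero} _ _ = refl
Piece-index-unique {n} {suc zero} {suc (suc _)} A≡[n] (B , z , _ , A≡B,z , _) =
  contradiction (trans (sym A≡B,z) A≡[n]) ⁺∷ʳ≢[ n ]
Piece-index-unique {n} {suc (suc _)} {suc zero} (B , z , _ , A≡B,z , _) A≡[n] =
  contradiction (trans (sym A≡B,z) A≡[n]) ⁺∷ʳ≢[ n ]
Piece-index-unique {r = suc (suc _)} {suc (suc _)}
  (B , _ , (_ , fB≡m) , refl , _) (B' , _ , (_ , fB'≡m') , A≡B',z' , _)
  with ⁺∷ʳ-injectiveˡ A≡B',z'
... | refl = cong suc (trans (sym fB≡m) fB'≡m')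

last-divisor : ∀ {n} → 1 ≤ n → ∀ A → Valid n A → ∃ λ r → r ∈ divisors n × Piece n r A
last-divisor {n} 1≤n A valid with snocView A
... | [] ∷ʳ′ x = 1 , from (∈-divisors 1≤n) (≤-refl , 1∣ n) , cong (_∷ []) (proj₂ valid)
... | (b ∷ bs) ∷ʳ′ z with to (Valid-⁺∷ʳ n (b ∷ bs) z) valid
...   | 1≤B , _ , eq = prefix-piece (f (b ∷ bs)) refl (f-positive (b ∷ bs) 1≤B) eq
  where
  prefix-piece : ∀ m → f (b ∷ bs) ≡ m → 1 ≤ m → (m + 1) * z ≡ n →
                 ∃ λ r → r ∈ divisors n × Piece n r ((b ∷ bs) ⁺∷ʳ z)
  prefix-piece m@(suc _) fB≡m _ eq =
    suc m , from (∈-divisors 1≤n) (s≤s z≤n , divides z (trans (sym r*z≡n) (*-comm (suc m) z))) ,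
    b ∷ bs , z , (1≤B , fB≡m) , refl , r*z≡n
    where
    r*z≡n : suc m * z ≡ n
    r*z≡n = trans (cong (_* z) (+-comm 1 m)) eq

piece-valid : ∀ {n r A} → 1 ≤ n → Piece n r A → Valid n A
piece-valid {r = suc zero} 1≤n refl = 1≤n ∷ [] , refl
piece-valid {n} {suc m@(suc _)} 1≤n (B , z , (1≤B , fB≡m) , refl , r*z≡n) =
  from (Valid-⁺∷ʳ n B z)
    (1≤B , factor-positive (suc m) z (subst (1 ≤_) (sym r*z≡n) 1≤n) ,
     trans (cong (λ k → (k + 1) * z) fB≡m) (trans (cong (_* z) (+-comm m 1)) r*z≡n))

Valid⇔pieces : ∀ {n} → 1 ≤ n → ∀ A → Valid n A ⇔ (∃ λ r → r ∈ divisors n × Piece n r A)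
Valid⇔pieces 1≤n A = mk⇔ (last-divisor 1≤n A) (λ (_ , _ , piece) → piece-valid 1≤n piece)

-- The piece of the divisor r has T(r - 1) elements: for r = 1 it is the
-- single vector (n), for r ≥ 2 it is the injective image of the vectors
-- with value r - 1 < n under B ↦ (B, n/r).
Piece-count : ∀ {n} (T : ℕ → ℕ) → T 0 ≡ 1 → (∀ m → 1 ≤ m → m < n → HasCount (Valid m) (T m)) →
              1 ≤ n → ∀ r → r ∈ divisors n → HasCount (Piece n r) (T (r ∸ 1))
Piece-count T _  _ 1≤n zero r∈ with () ← proj₁ (to (∈-divisors 1≤n) r∈)
Piece-count {n} T T0≡1 _ _ (suc zero) _ =
  subst (HasCount (Piece n 1)) (sym T0≡1) (HasCount-singleton (n ∷ []))
Piece-count {n} T _ counts 1≤n r@(suc m@(suc _)) r∈ with to (∈-divisors 1≤n) r∈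
... | _ , r∣n@(divides q n≡q*r) =
  HasCount-cong extension
    (HasCount-image (_⁺∷ʳ q) ⁺∷ʳ-injectiveˡ (counts m (s≤s z≤n) (∣⇒≤ {{>-nonZero 1≤n}} r∣n)))
  where
  extension : ∀ A → (∃ λ B → Valid m B × A ≡ B ⁺∷ʳ q) ⇔ Piece n r A
  extension A = mk⇔
    (λ (B , valid , A≡B,q) → B , q , valid , A≡B,q , trans (*-comm r q) (sym n≡q*r))
    (λ (B , z , valid , A≡B,z , r*z≡n) →
       B , valid , subst (λ w → A ≡ B ⁺∷ʳ w)
                         (*-cancelˡ-≡ z q r (trans r*z≡n (trans n≡q*r (*-comm q r)))) A≡B,z)

Valid-count : ∀ {n} (T : ℕ → ℕ) → 1 ≤ n → T 0 ≡ 1 →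
              (∀ m → 1 ≤ m → m < n → HasCount (Valid m) (T m)) →
              HasCount (Valid n) (divisorSum n (λ r → T (r ∸ 1)))
Valid-count {n} T 1≤n T0≡1 counts =
  HasCount-cong (λ A → ⇔.sym (Valid⇔pieces 1≤n A))
    (HasCount-Σ {P = Piece n} (λ r → T (r ∸ 1)) (divisors n) (divisors-unique n)
                Piece-index-unique (Piece-count T T0≡1 counts 1≤n))

-- The recursion T(0) = 1, T(n) = Σ_{r ∣ n} T(r - 1), evaluated with a fuel
-- bound; the fuel only needs to dominate n (r - 1 < n for every divisor r).
T-fuel : ℕ → ℕ → ℕ
T-fuel _          zero    = 1
T-fuel zero       (suc n) = 0
T-fuel (suc fuel) (suc n) = divisorSum (suc n) (λ r → T-fuel fuel (r ∸ 1))

T-fuel-counts : ∀ fuel n → 1 ≤ n → n ≤ fuel → HasCount (Valid n) (T-fuel fuel n)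
T-fuel-counts (suc fuel) (suc n) 1≤n (s≤s n≤fuel) =
  Valid-count (T-fuel fuel) 1≤n refl
    (λ m 1≤m m<1+n → T-fuel-counts fuel m 1≤m (≤-trans (≤-pred m<1+n) n≤fuel))

T : ℕ → ℕ
T n = T-fuel n n

T-IsT : IsT T
T-IsT = refl , λ n 1≤n → T-fuel-counts n n 1≤n ≤-refl

-- Theorem 2: a counting function exists, and every counting function
-- satisfies T(n) = Σ_{r ∣ n} T(r - 1), since both sides count the vectors
-- with f(A) = n.
theorem2 : Σ (ℕ → ℕ) IsT
    × ((T : ℕ → ℕ) → IsT T → (n : ℕ) → 1 ≤ n → T n ≡ divisorSum n (λ r → T (r ∸ 1)))
theorem2 = (T , T-IsT) , recursion
  where
  recursion : (T : ℕ → ℕ) → IsT T → (n : ℕ) → 1 ≤ n → T n ≡ divisorSum n (λ r → T (r ∸ 1))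
  recursion T (T0≡1 , counts) n 1≤n =
    HasCount-unique (counts n 1≤n) (Valid-count T 1≤n T0≡1 (λ m 1≤m _ → counts m 1≤m))
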